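{- Let $p$ be an odd prime, $\alpha$ a primitive root modulo $p$, and $\mathcal{R}_p=\{(i,j)\in\mathbb{Z}^2:\alpha^j\equiv i\bmod p\}$. Let $(i,j)\in\mathbb{Z}^2$ be such that $(i,j)\in\mathcal{R}_p$ and $(i+1,j+1)\in\mathcal{R}_p$, let $S=\{i,\dots,i+p-1\}\times\{j,\dots,j+p-2\}$, and let $\mathcal{B}=(\mathcal{R}_p\cap S)\cup\{(i,j+p-1),(i+p,j),(i+p+1,j+p)\}$. Then $\mathcal{B}$ is a $\mathrm{DD}(p+2)$, all of whose points lie in a $(p+1)\times(p+2)$ rectangle (namely $\{i,\dots,i+p+1\}\times\{j,\dots,j+p\}$).
   Context: A $\mathrm{DD}(m)$ is a set of $m$ points $\mathbf{v}_1,\dots,\mathbf{v}_m$ of $\mathbb{Z}^2$ whose difference vectors $\mathbf{v}_i-\mathbf{v}_j$ ($i\ne j$) are all distinct. -}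

module Defs where

open import Data.Nat as ℕ using (ℕ; _∸_)
open import Data.Integer using (ℤ; +_; _+_; _-_; _^_; _≤_)
open import Data.Integer.Divisibility using (_∣_)
open import Data.Sum using (_⊎_)
open import Data.Product using (_×_; _,_; ∃)
open import Data.List using (List; length)
open import Data.List.Membership.Propositional using (_∈_)
open import Data.List.Relation.Unary.Unique.Propositional using (Unique)
open import Relation.Binary.PropositionalEquality using (_≡_; _≢_)
open import Relation.Nullary using (¬_)

Point : Set
Point = ℤ × ℤ

_-ᵖ_ : Point → Point → Point
(a , b) -ᵖ (c , d) = (a - c , b - d)

PrimitiveRoot : ℕ → ℤ → Set
PrimitiveRoot p α =
  ¬ ((+ p) ∣ α) ×
  (∀ (k : ℕ) → 1 ℕ.≤ k → k ℕ.< p ∸ 1 → ¬ ((+ p) ∣ (α ^ k - + 1)))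

-- (i , j) ∈ ℛ_p  iff  α^j ≡ i (mod p).  For j ∈ ℤ possibly negative,
-- α^j mod p is read as α^k mod p for any natural k ≡ j (mod p-1)
-- (well defined by Fermat's little theorem).
InR : ℕ → ℤ → Point → Set
InR p α (i , j) = ∃ λ (k : ℕ) → ((+ (p ∸ 1)) ∣ (j - + k)) × ((+ p) ∣ (α ^ k - i))

InS : ℕ → ℤ → ℤ → Point → Set
InS p i j (x , y) =
  (i ≤ x) × (x ≤ i + + (p ∸ 1)) × (j ≤ y) × (y ≤ j + + (p ∸ 2))

InB : ℕ → ℤ → ℤ → ℤ → Point → Set
InB p α i j q =
  (InR p α q × InS p i j q)
  ⊎ (q ≡ (i , j + + (p ∸ 1)))
  ⊎ (q ≡ (i + + p , j))
  ⊎ (q ≡ (i + + (p ℕ.+ 1) , j + + p))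

IsDD : ℕ → List Point → Set
IsDD m L =
  length L ≡ m × Unique L ×
  (∀ {a b c d} → a ∈ L → b ∈ L → c ∈ L → d ∈ L →
     a ≢ b → c ≢ d → (a -ᵖ b) ≡ (c -ᵖ d) → (a ≡ c × b ≡ d))

InRect : ℕ → ℤ → ℤ → Point → Set
InRect p i j (x , y) =
  (i ≤ x) × (x ≤ i + + (p ℕ.+ 1)) × (j ≤ y) × (y ≤ j + + p)

-- Write n = p - 1 and Λ = pℤ × nℤ. The set ℛ_p is a union of Λ-cosets, and modulo Λ it is a
-- Welch Costas array: let a - b = c - d with a, b, c, d ∈ ℛ_p, of exponents k_a, k_b, k_c, k_d.
-- Either k_a ≡ k_b (mod n), or with δ ≡ k_a - k_b ≢ 0 (mod n) one gets
-- (α^δ - 1)(α^k_b - α^k_d) ≡ 0 (mod p), hence k_b ≡ k_d (mod n). So a - b ∈ Λ or b - d ∈ Λ, and in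
-- the second case a - c = b - d ∈ Λ as well. A subset of ℛ_p is therefore a DD as soon as its pairs
-- of Λ-congruent points are determined by their differences. Now 𝓑 ⊆ ℛ_p consists of the n points
-- of ℛ_p ∩ S, one in each row class, and of (i, j) + (0, n), (i, j) + (p, 0), (i + 1, j + 1) + (p, n),
-- where (i, j) and (i + 1, j + 1) are themselves points of ℛ_p ∩ S. The differences within a class,
-- ±(0, n), ±(p, 0), ±(p, -n) and ±(p, n), are pairwise distinct.

module Submission where

open import Defs

module _ where

  open import Level using (0ℓ)
  open import Data.Nat as ℕ using (ℕ; zero; suc; _∸_; _%_; _/_)
  import Data.Nat.Properties as ℕ
  import Data.Nat.Divisibility as ℕ
  open import Data.Nat.DivMod using (m≡m%n+[m/n]*n)
  open import Data.Nat.Primality using (Prime; euclidsLemma; ¬prime[1])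
  open import Data.Integer
    using (ℤ; +_; -[1+_]; ∣_∣; _+_; _-_; _*_; -_; _^_; _%ℕ_; _/ℕ_; _≤_; +≤+; NonZero)
  import Data.Integer.Properties as ℤ
  open import Data.Integer.DivMod using (a≡a%ℕn+[a/ℕn]*n; n%ℕd<d)
  open import Data.Integer.Divisibility.Signed
    using (_∣_; divides; ∣ᵤ⇒∣; ∣⇒∣ᵤ; ∣m∣n⇒∣m+n; ∣m⇒∣-m; ∣n⇒∣m*n; ∣m⇒∣m*n)
  open import Data.Integer.Tactic.RingSolver using (solve-∀)
  open import Data.Fin as Fin using (Fin; toℕ; fromℕ<; punchOut)
  import Data.Fin.Properties as Fin
  open import Data.Maybe using (Maybe; just; nothing)
  open import Data.Sum as Sum using (_⊎_; inj₁; inj₂; [_,_]′)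
  open import Data.Product as Product using (_×_; _,_; ∃; ∃₂; proj₁; proj₂)
  open import Data.Product.Properties using (≡-dec)
  open import Data.List using (List; _∷_; map; allFin; length)
  open import Data.List.Properties using (length-map; length-tabulate)
  open import Data.List.Membership.Propositional using (_∈_)
  open import Data.List.Membership.Propositional.Properties using (∈-map⁺; ∈-map⁻; ∈-allFin)
  open import Data.List.Relation.Unary.Any using (here; there)
  open import Data.List.Relation.Unary.All as All using (All; _∷_)
  import Data.List.Relation.Unary.All.Properties as All
  open import Data.List.Relation.Unary.Unique.Propositional using (Unique; _∷_)
  import Data.List.Relation.Unary.Unique.Propositional.Properties as Unique
  open import Function using (_∘_; id; flip)
  open import Function.Bundles using (_⇔_; mk⇔)
  open import Relation.Binary.Bundles using (Setoid)
  open import Relation.Binary.Structures using (IsEquivalence)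
  open import Relation.Binary.PropositionalEquality
  open import Relation.Nullary using (¬_; contradiction; yes; no)

  -- Congruences modulo m

  infix 4 _≡_mod_

  -- A record rather than a synonym for + m ∣ a - b, so that a and b can be inferred.
  record _≡_mod_ (a b : ℤ) (m : ℕ) : Set where
    constructor ∣⇒≡-mod
    field ≡-mod⇒∣ : + m ∣ a - b

  open _≡_mod_ public

  module _ {m : ℕ} where

    ≡-mod-reflexive : ∀ {a b} → a ≡ b → a ≡ b mod m
    ≡-mod-reflexive {a} refl = ∣⇒≡-mod (divides (+ 0) (ℤ.+-inverseʳ a))

    ≡-mod-refl : ∀ {a} → a ≡ a mod m
    ≡-mod-refl = ≡-mod-reflexive refl

    ≡-mod-sym : ∀ {a b} → a ≡ b mod m → b ≡ a mod m
    ≡-mod-sym {a} {b} (∣⇒≡-mod m∣a-b) = ∣⇒≡-mod (subst (+ m ∣_) (negate a b) (∣m⇒∣-m m∣a-b))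
      where
      negate : ∀ a b → - (a - b) ≡ b - a
      negate = solve-∀

    ≡-mod-trans : ∀ {a b c} → a ≡ b mod m → b ≡ c mod m → a ≡ c mod m
    ≡-mod-trans {a} {b} {c} (∣⇒≡-mod m∣a-b) (∣⇒≡-mod m∣b-c) =
      ∣⇒≡-mod (subst (+ m ∣_) (telescope a b c) (∣m∣n⇒∣m+n m∣a-b m∣b-c))
      where
      telescope : ∀ a b c → (a - b) + (b - c) ≡ a - c
      telescope = solve-∀

    ≡-mod-isEquivalence : IsEquivalence (_≡_mod m)
    ≡-mod-isEquivalence = record { refl = ≡-mod-refl ; sym = ≡-mod-sym ; trans = ≡-mod-trans }

    +-cong-mod : ∀ {a b c d} → a ≡ b mod m → c ≡ d mod m → a + c ≡ b + d mod m
    +-cong-mod {a} {b} {c} {d} (∣⇒≡-mod m∣a-b) (∣⇒≡-mod m∣c-d) =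
      ∣⇒≡-mod (subst (+ m ∣_) (regroup a b c d) (∣m∣n⇒∣m+n m∣a-b m∣c-d))
      where
      regroup : ∀ a b c d → (a - b) + (c - d) ≡ (a + c) - (b + d)
      regroup = solve-∀

    neg-cong-mod : ∀ {a b} → a ≡ b mod m → - a ≡ - b mod m
    neg-cong-mod {a} {b} (∣⇒≡-mod m∣a-b) = ∣⇒≡-mod (subst (+ m ∣_) (regroup a b) (∣m⇒∣-m m∣a-b))
      where
      regroup : ∀ a b → - (a - b) ≡ - a - - b
      regroup = solve-∀

    sub-cong-mod : ∀ {a b c d} → a ≡ b mod m → c ≡ d mod m → a - c ≡ b - d mod m
    sub-cong-mod a≡b c≡d = +-cong-mod a≡b (neg-cong-mod c≡d)

    *-cong-mod : ∀ {a b c d} → a ≡ b mod m → c ≡ d mod m → a * c ≡ b * d mod m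
    *-cong-mod {a} {b} {c} {d} (∣⇒≡-mod m∣a-b) (∣⇒≡-mod m∣c-d) =
      ∣⇒≡-mod (subst (+ m ∣_) (regroup a b c d) (∣m∣n⇒∣m+n (∣n⇒∣m*n a m∣c-d) (∣m⇒∣m*n d m∣a-b)))
      where
      regroup : ∀ a b c d → a * (c - d) + (a - b) * d ≡ a * c - b * d
      regroup = solve-∀

    ^-cong-mod : ∀ {a b} k → a ≡ b mod m → a ^ k ≡ b ^ k mod m
    ^-cong-mod zero    a≡b = ≡-mod-refl
    ^-cong-mod (suc k) a≡b = *-cong-mod a≡b (^-cong-mod k a≡b)

    +-congˡ-mod : ∀ c {a b} → a ≡ b mod m → c + a ≡ c + b mod m
    +-congˡ-mod c = +-cong-mod (≡-mod-refl {c})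

    *-congˡ-mod : ∀ c {a b} → a ≡ b mod m → c * a ≡ c * b mod m
    *-congˡ-mod c = *-cong-mod (≡-mod-refl {c})

    sub-congʳ-mod : ∀ c {a b} → a ≡ b mod m → a - c ≡ b - c mod m
    sub-congʳ-mod c a≡b = sub-cong-mod a≡b (≡-mod-refl {c})

    +-cancelˡ-≡-mod : ∀ {c a b} → c + a ≡ c + b mod m → a ≡ b mod m
    +-cancelˡ-≡-mod {c} {a} {b} (∣⇒≡-mod m∣ca-cb) = ∣⇒≡-mod (subst (+ m ∣_) (cancel c a b) m∣ca-cb)
      where
      cancel : ∀ c a b → (c + a) - (c + b) ≡ a - b
      cancel = solve-∀

    +-multiple-≡-mod : ∀ a q → a + q * + m ≡ a mod m
    +-multiple-≡-mod a q = ∣⇒≡-mod (divides q (cancel a q (+ m)))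
      where
      cancel : ∀ a q m → (a + q * m) - a ≡ q * m
      cancel = solve-∀

    +-modulus-≡-mod : ∀ a → a + + m ≡ a mod m
    +-modulus-≡-mod a = ∣⇒≡-mod (divides (+ 1) (cancel a (+ m)))
      where
      cancel : ∀ a m → (a + m) - a ≡ + 1 * m
      cancel = solve-∀

    ≡-mod-0⇒∣ : ∀ {a} → a ≡ + 0 mod m → + m ∣ a
    ≡-mod-0⇒∣ {a} (∣⇒≡-mod m∣a-0) = subst (+ m ∣_) (ℤ.+-identityʳ a) m∣a-0

    ∣⇒≡-mod-0 : ∀ {a} → + m ∣ a → a ≡ + 0 mod m
    ∣⇒≡-mod-0 {a} m∣a = ∣⇒≡-mod (subst (+ m ∣_) (sym (ℤ.+-identityʳ a)) m∣a)

  ≡-mod-setoid : ℕ → Setoid 0ℓ 0ℓ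
  ≡-mod-setoid m = record { isEquivalence = ≡-mod-isEquivalence {m} }

  module ≡-mod-Reasoning (m : ℕ) where
    open import Relation.Binary.Reasoning.Setoid (≡-mod-setoid m) public

  module _ (m : ℕ) .{{_ : ℕ.NonZero m}} where

    ≡-%ℕ-mod : ∀ a → a ≡ + (a %ℕ m) mod m
    ≡-%ℕ-mod a = ≡-mod-trans (≡-mod-reflexive (a≡a%ℕn+[a/ℕn]*n a m))
                             (+-multiple-≡-mod (+ (a %ℕ m)) (a /ℕ m))

    %ℕ-< : ∀ a → a %ℕ m ℕ.< m
    %ℕ-< a = n%ℕd<d a m

    ≡-mod-0⊎positive-residue : ∀ a → a ≡ + 0 mod m ⊎ ∃ λ r → 1 ℕ.≤ r × r ℕ.< m × a ≡ + r mod m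
    ≡-mod-0⊎positive-residue a with a %ℕ m | %ℕ-< a | ≡-%ℕ-mod a
    ... | zero   | _   | a≡0 = inj₁ a≡0
    ... | suc r′ | r<m | a≡r = inj₂ (suc r′ , ℕ.s≤s ℕ.z≤n , r<m , a≡r)

  private
    ∣-<⇒≡0 : ∀ {m k} → m ℕ.∣ k → k ℕ.< m → k ≡ 0
    ∣-<⇒≡0 {k = zero}  _   _   = refl
    ∣-<⇒≡0 {k = suc k} m∣k k<m = contradiction m∣k (ℕ.>⇒∤ k<m)

    ≥-≡-mod⇒≡ : ∀ {m x y} → y ℕ.≤ x → x ℕ.< m → + x ≡ + y mod m → x ≡ y
    ≥-≡-mod⇒≡ {m} {x} {y} y≤x x<m (∣⇒≡-mod m∣x-y) = ℕ.≤-antisym (ℕ.m∸n≡0⇒m≤n x∸y≡0) y≤x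
      where
      ∣x-y∣ : ∣ + x - + y ∣ ≡ x ∸ y
      ∣x-y∣ = trans (cong ∣_∣ (ℤ.m-n≡m⊖n x y)) (trans (ℤ.∣m⊖n∣≡∣n⊖m∣ x y) (ℤ.∣⊖∣-≤ y≤x))
      x∸y≡0 : x ∸ y ≡ 0
      x∸y≡0 = ∣-<⇒≡0 (subst (m ℕ.∣_) ∣x-y∣ (∣⇒∣ᵤ m∣x-y)) (ℕ.≤-<-trans (ℕ.m∸n≤m x y) x<m)

  ≡-mod⇒≡ : ∀ {m x y} → x ℕ.< m → y ℕ.< m → + x ≡ + y mod m → x ≡ y
  ≡-mod⇒≡ {x = x} {y} x<m y<m x≡y with ℕ.≤-total y x
  ... | inj₁ y≤x = ≥-≡-mod⇒≡ y≤x x<m x≡y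
  ... | inj₂ x≤y = sym (≥-≡-mod⇒≡ x≤y y<m (≡-mod-sym x≡y))

  private
    sub-cancelʳ : ∀ {x y z} → x - z ≡ y - z → x ≡ y
    sub-cancelʳ {x} {y} {z} eq = trans (sym (sub-add x z)) (trans (cong (_+ z) eq) (sub-add y z))
      where
      sub-add : ∀ x z → x - z + z ≡ x
      sub-add = solve-∀

    sub-cancelˡ : ∀ {x y z} → x - y ≡ x - z → y ≡ z
    sub-cancelˡ {x} {y} {z} eq = trans (sym (sub-sub x y)) (trans (cong (λ u → x - u) eq) (sub-sub x z))
      where
      sub-sub : ∀ x y → x - (x - y) ≡ y
      sub-sub = solve-∀

    sub-swap : ∀ {x y z w} → x - y ≡ z - w → y - w ≡ x - z
    sub-swap {x} {y} {z} {w} eq = begin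
      y - w             ≡⟨ regroup x y w ⟩
      (x - w) - (x - y) ≡⟨ cong (λ u → (x - w) - u) eq ⟩
      (x - w) - (z - w) ≡⟨ cancel x z w ⟩
      x - z             ∎
      where
      open ≡-Reasoning
      regroup : ∀ x y w → y - w ≡ (x - w) - (x - y)
      regroup = solve-∀
      cancel : ∀ x z w → (x - w) - (z - w) ≡ x - z
      cancel = solve-∀

  -ᵖ-cancelʳ : ∀ {a b c} → a -ᵖ b ≡ c -ᵖ b → a ≡ c
  -ᵖ-cancelʳ {xa , ya} {xb , yb} {xc , yc} eq =
    cong₂ _,_ (sub-cancelʳ {xa} {xc} {xb} (cong proj₁ eq)) (sub-cancelʳ {ya} {yc} {yb} (cong proj₂ eq))

  -ᵖ-cancelˡ : ∀ {a b c} → a -ᵖ b ≡ a -ᵖ c → b ≡ c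
  -ᵖ-cancelˡ {xa , ya} {xb , yb} {xc , yc} eq =
    cong₂ _,_ (sub-cancelˡ {xa} {xb} {xc} (cong proj₁ eq)) (sub-cancelˡ {ya} {yb} {yc} (cong proj₂ eq))

  -ᵖ-swap : ∀ {a b c d} → a -ᵖ b ≡ c -ᵖ d → b -ᵖ d ≡ a -ᵖ c
  -ᵖ-swap {xa , ya} {xb , yb} {xc , yc} {xd , yd} eq =
    cong₂ _,_ (sub-swap {xa} {xb} {xc} {xd} (cong proj₁ eq)) (sub-swap {ya} {yb} {yc} {yd} (cong proj₂ eq))

  -- Prime moduli

  module _ {p : ℕ} (p-prime : Prime p) where

    prime-≡0-mod : ∀ a b → a * b ≡ + 0 mod p → a ≡ + 0 mod p ⊎ b ≡ + 0 mod p
    prime-≡0-mod a b ab≡0 =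
      Sum.map ℕ∣⇒≡0 ℕ∣⇒≡0
        (euclidsLemma ∣ a ∣ ∣ b ∣ p-prime (subst (p ℕ.∣_) (ℤ.abs-* a b) (∣⇒∣ᵤ (≡-mod-0⇒∣ ab≡0))))
      where
      ℕ∣⇒≡0 : ∀ {c} → p ℕ.∣ ∣ c ∣ → c ≡ + 0 mod p
      ℕ∣⇒≡0 p∣c = ∣⇒≡-mod-0 (∣ᵤ⇒∣ p∣c)

    *-cancelˡ-≡-mod : ∀ {c a b} → ¬ c ≡ + 0 mod p → c * a ≡ c * b mod p → a ≡ b mod p
    *-cancelˡ-≡-mod {c} {a} {b} c≢0 ca≡cb =
      [ flip contradiction c≢0 , (λ a-b≡0 → ∣⇒≡-mod (≡-mod-0⇒∣ a-b≡0)) ]′ (prime-≡0-mod c (a - b) c[a-b]≡0)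
      where
      factor : ∀ c a b → c * a - c * b ≡ c * (a - b)
      factor = solve-∀
      c[a-b]≡0 : c * (a - b) ≡ + 0 mod p
      c[a-b]≡0 = ∣⇒≡-mod-0 (subst (+ p ∣_) (factor c a b) (≡-mod⇒∣ ca≡cb))

    ^-≢0-mod : ∀ {a} k → ¬ a ≡ + 0 mod p → ¬ a ^ k ≡ + 0 mod p
    ^-≢0-mod zero    a≢0 1≡0 = ¬prime[1] (subst Prime (ℕ.∣1⇒≡1 (∣⇒∣ᵤ (≡-mod-0⇒∣ 1≡0))) p-prime)
    ^-≢0-mod {a} (suc k) a≢0 a^[1+k]≡0 with prime-≡0-mod a (a ^ k) a^[1+k]≡0
    ... | inj₁ a≡0   = a≢0 a≡0
    ... | inj₂ a^k≡0 = ^-≢0-mod k a≢0 a^k≡0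

    ^-∸-≡1-mod : ∀ {a x y} → ¬ a ≡ + 0 mod p → x ℕ.≤ y → a ^ x ≡ a ^ y mod p → a ^ (y ∸ x) ≡ + 1 mod p
    ^-∸-≡1-mod {a} {x} {y} a≢0 x≤y a^x≡a^y = *-cancelˡ-≡-mod (^-≢0-mod x a≢0) (begin
      a ^ x * a ^ (y ∸ x) ≡⟨ ℤ.^-distribˡ-+-* a x (y ∸ x) ⟨
      a ^ (x ℕ.+ (y ∸ x)) ≡⟨ cong (a ^_) (ℕ.m+[n∸m]≡n x≤y) ⟩
      a ^ y               ≈⟨ a^x≡a^y ⟨
      a ^ x               ≡⟨ ℤ.*-identityʳ (a ^ x) ⟨
      a ^ x * + 1         ∎)
      where open ≡-mod-Reasoning p

  module _ {n : ℕ} {a : ℤ} (p-prime : Prime (suc n)) (a≢0 : ¬ a ≡ + 0 mod suc n) where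

    private
      residue : ℕ → Fin (suc n)
      residue k = fromℕ< (%ℕ-< (suc n) (a ^ k))

      ≡-residue : ∀ k → a ^ k ≡ + toℕ (residue k) mod suc n
      ≡-residue k = ≡-mod-trans (≡-%ℕ-mod (suc n) (a ^ k)) (≡-mod-reflexive (cong +_ (sym (Fin.toℕ-fromℕ< _))))

      residue≢0 : ∀ k → Fin.zero ≢ residue k
      residue≢0 k 0≡r =
        ^-≢0-mod p-prime k a≢0 (≡-mod-trans (≡-residue k) (≡-mod-reflexive (cong (+_ ∘ toℕ) (sym 0≡r))))

      nonzero-residue : Fin (suc n) → Fin n
      nonzero-residue k = punchOut (residue≢0 (toℕ k))

      nonzero-residue-injective : ∀ k₁ k₂ → nonzero-residue k₁ ≡ nonzero-residue k₂ →
                                  residue (toℕ k₁) ≡ residue (toℕ k₂)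
      nonzero-residue-injective k₁ k₂ = Fin.punchOut-injective (residue≢0 (toℕ k₁)) (residue≢0 (toℕ k₂))

      collision⇒order : (∃₂ λ k₁ k₂ → k₁ Fin.< k₂ × nonzero-residue k₁ ≡ nonzero-residue k₂) →
                        ∃ λ e → 1 ℕ.≤ e × e ℕ.≤ n × a ^ e ≡ + 1 mod suc n
      collision⇒order (k₁ , k₂ , k₁<k₂ , same-residue) =
        toℕ k₂ ∸ toℕ k₁ , ℕ.m<n⇒0<n∸m k₁<k₂ , ℕ.≤-trans (ℕ.m∸n≤m (toℕ k₂) (toℕ k₁)) (ℕ.≤-pred (Fin.toℕ<n k₂)) ,
        ^-∸-≡1-mod p-prime a≢0 (ℕ.<⇒≤ k₁<k₂) (begin
          a ^ toℕ k₁                ≈⟨ ≡-residue (toℕ k₁) ⟩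
          + toℕ (residue (toℕ k₁)) ≡⟨ cong (+_ ∘ toℕ) (nonzero-residue-injective k₁ k₂ same-residue) ⟩
          + toℕ (residue (toℕ k₂)) ≈⟨ ≡-residue (toℕ k₂) ⟨
          a ^ toℕ k₂                ∎)
        where open ≡-mod-Reasoning (suc n)

    order-exists : ∃ λ e → 1 ℕ.≤ e × e ℕ.≤ n × a ^ e ≡ + 1 mod suc n
    order-exists = collision⇒order (Fin.pigeonhole (ℕ.n<1+n n) nonzero-residue)

  -- Powers of a primitive root, and the set ℛ_p

  module PrimitiveRootModulo (n : ℕ) .{{_ : ℕ.NonZero n}} (p-prime : Prime (suc n))
                             (α : ℤ) (α-primitive : PrimitiveRoot (suc n) α) where

    p : ℕ
    p = suc n

    α≢0 : ¬ α ≡ + 0 mod p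
    α≢0 α≡0 = proj₁ α-primitive (∣⇒∣ᵤ (≡-mod-0⇒∣ α≡0))

    α^k≢1 : ∀ {k} → 1 ℕ.≤ k → k ℕ.< n → ¬ α ^ k ≡ + 1 mod p
    α^k≢1 {k} 1≤k k<n α^k≡1 = proj₂ α-primitive k 1≤k k<n (∣⇒∣ᵤ (≡-mod⇒∣ α^k≡1))

    α^n≡1 : α ^ n ≡ + 1 mod p
    α^n≡1 = order≡n (order-exists p-prime α≢0)
      where
      order≡n : (∃ λ e → 1 ℕ.≤ e × e ℕ.≤ n × α ^ e ≡ + 1 mod p) → α ^ n ≡ + 1 mod p
      order≡n (e , 1≤e , e≤n , α^e≡1) =
        [ (λ e<n → contradiction α^e≡1 (α^k≢1 1≤e e<n)) , (λ e≡n → subst (λ k → α ^ k ≡ + 1 mod p) e≡n α^e≡1) ]′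
        (ℕ.m≤n⇒m<n∨m≡n e≤n)

    α^k≡α^[k%n] : ∀ k → α ^ k ≡ α ^ (k % n) mod p
    α^k≡α^[k%n] k = begin
      α ^ k                                ≡⟨ cong (α ^_) (m≡m%n+[m/n]*n k n) ⟩
      α ^ (k % n ℕ.+ (k / n) ℕ.* n)        ≡⟨ ℤ.^-distribˡ-+-* α (k % n) ((k / n) ℕ.* n) ⟩
      α ^ (k % n) * α ^ ((k / n) ℕ.* n)    ≡⟨ cong (λ e → α ^ (k % n) * α ^ e) (ℕ.*-comm (k / n) n) ⟩
      α ^ (k % n) * α ^ (n ℕ.* (k / n))    ≡⟨ cong (α ^ (k % n) *_) (ℤ.^-*-assoc α n (k / n)) ⟨
      α ^ (k % n) * (α ^ n) ^ (k / n)      ≈⟨ *-congˡ-mod (α ^ (k % n)) (^-cong-mod (k / n) α^n≡1) ⟩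
      α ^ (k % n) * (+ 1) ^ (k / n)        ≡⟨ cong (α ^ (k % n) *_) (ℤ.^-zeroˡ (k / n)) ⟩
      α ^ (k % n) * + 1                    ≡⟨ ℤ.*-identityʳ (α ^ (k % n)) ⟩
      α ^ (k % n)                          ∎
      where open ≡-mod-Reasoning p

    private
      α^-injective-≤ : ∀ {x y} → x ℕ.≤ y → y ℕ.< n → α ^ x ≡ α ^ y mod p → x ≡ y
      α^-injective-≤ {x} {y} x≤y y<n α^x≡α^y with ℕ.m≤n⇒m<n∨m≡n x≤y
      ... | inj₂ x≡y = x≡y
      ... | inj₁ x<y = contradiction (^-∸-≡1-mod p-prime α≢0 x≤y α^x≡α^y)
                                     (α^k≢1 (ℕ.m<n⇒0<n∸m x<y) (ℕ.≤-<-trans (ℕ.m∸n≤m y x) y<n))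

    α^-injective-< : ∀ {x y} → x ℕ.< n → y ℕ.< n → α ^ x ≡ α ^ y mod p → x ≡ y
    α^-injective-< {x} {y} x<n y<n α^x≡α^y with ℕ.≤-total x y
    ... | inj₁ x≤y = α^-injective-≤ x≤y y<n α^x≡α^y
    ... | inj₂ y≤x = sym (α^-injective-≤ y≤x x<n (≡-mod-sym α^x≡α^y))

    α^-periodic : ∀ {a b} → + a ≡ + b mod n → α ^ a ≡ α ^ b mod p
    α^-periodic {a} {b} a≡b = begin
      α ^ a       ≈⟨ α^k≡α^[k%n] a ⟩
      α ^ (a % n) ≡⟨ cong (α ^_) a%n≡b%n ⟩
      α ^ (b % n) ≈⟨ α^k≡α^[k%n] b ⟨
      α ^ b       ∎
      where
      open ≡-mod-Reasoning p
      a%n≡b%n : a % n ≡ b % n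
      a%n≡b%n = ≡-mod⇒≡ (%ℕ-< n (+ a)) (%ℕ-< n (+ b))
                  (≡-mod-trans (≡-mod-sym (≡-%ℕ-mod n (+ a))) (≡-mod-trans a≡b (≡-%ℕ-mod n (+ b))))

    α^-injective : ∀ {a b} → α ^ a ≡ α ^ b mod p → + a ≡ + b mod n
    α^-injective {a} {b} α^a≡α^b = begin
      + a       ≈⟨ ≡-%ℕ-mod n (+ a) ⟩
      + (a % n) ≡⟨ cong +_ (α^-injective-< (%ℕ-< n (+ a)) (%ℕ-< n (+ b)) α^[a%n]≡α^[b%n]) ⟩
      + (b % n) ≈⟨ ≡-%ℕ-mod n (+ b) ⟨
      + b       ∎
      where
      open ≡-mod-Reasoning n
      α^[a%n]≡α^[b%n] : α ^ (a % n) ≡ α ^ (b % n) mod p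
      α^[a%n]≡α^[b%n] = ≡-mod-trans (≡-mod-sym (α^k≡α^[k%n] a)) (≡-mod-trans α^a≡α^b (α^k≡α^[k%n] b))

    InΛ : Point → Set
    InΛ w = (+ p ∣ proj₁ w) × (+ n ∣ proj₂ w)

    exponent : ∀ q → InR p α q → ℕ
    exponent _ = proj₁

    y≡exponent : ∀ q (q∈R : InR p α q) → proj₂ q ≡ + exponent q q∈R mod n
    y≡exponent _ (_ , n∣y-k , _) = ∣⇒≡-mod (∣ᵤ⇒∣ n∣y-k)

    α^exponent≡x : ∀ q (q∈R : InR p α q) → α ^ exponent q q∈R ≡ proj₁ q mod p
    α^exponent≡x _ (_ , _ , p∣α^k-x) = ∣⇒≡-mod (∣ᵤ⇒∣ p∣α^k-x)

    exponent⇒InR : ∀ {x y} k → y ≡ + k mod n → α ^ k ≡ x mod p → InR p α (x , y)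
    exponent⇒InR k y≡k α^k≡x = k , ∣⇒∣ᵤ (≡-mod⇒∣ y≡k) , ∣⇒∣ᵤ (≡-mod⇒∣ α^k≡x)

    InR-resp-≡-mod : ∀ {x y x′ y′} → x ≡ x′ mod p → y ≡ y′ mod n → InR p α (x , y) → InR p α (x′ , y′)
    InR-resp-≡-mod {x} {y} x≡x′ y≡y′ xy∈R =
      exponent⇒InR (exponent (x , y) xy∈R) (≡-mod-trans (≡-mod-sym y≡y′) (y≡exponent (x , y) xy∈R))
                   (≡-mod-trans (α^exponent≡x (x , y) xy∈R) x≡x′)

    InR-functional : ∀ a b → InR p α a → InR p α b → proj₂ a ≡ proj₂ b mod n → proj₁ a ≡ proj₁ b mod p
    InR-functional a b a∈R b∈R ya≡yb =
      ≡-mod-trans (≡-mod-sym (α^exponent≡x a a∈R)) (≡-mod-trans (α^-periodic ka≡kb) (α^exponent≡x b b∈R))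
      where
      ka≡kb : + exponent a a∈R ≡ + exponent b b∈R mod n
      ka≡kb = ≡-mod-trans (≡-mod-sym (y≡exponent a a∈R)) (≡-mod-trans ya≡yb (y≡exponent b b∈R))

    ≡-exponent⇒InΛ : ∀ a b (a∈R : InR p α a) (b∈R : InR p α b) →
                     + exponent a a∈R ≡ + exponent b b∈R mod n → InΛ (a -ᵖ b)
    ≡-exponent⇒InΛ a b a∈R b∈R ka≡kb =
      ≡-mod⇒∣ (InR-functional a b a∈R b∈R ya≡yb) , ≡-mod⇒∣ ya≡yb
      where
      ya≡yb : proj₂ a ≡ proj₂ b mod n
      ya≡yb = ≡-mod-trans (y≡exponent a a∈R) (≡-mod-trans ka≡kb (≡-mod-sym (y≡exponent b b∈R)))

    private
      α^-shift : ∀ {k l δ} → + k - + l ≡ + δ mod n → α ^ k ≡ α ^ l * α ^ δ mod p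
      α^-shift {k} {l} {δ} k-l≡δ = ≡-mod-trans (α^-periodic k≡l+δ) (≡-mod-reflexive (ℤ.^-distribˡ-+-* α l δ))
        where
        open ≡-mod-Reasoning n
        split : ∀ k l → k ≡ l + (k - l)
        split = solve-∀
        k≡l+δ : + k ≡ + (l ℕ.+ δ) mod n
        k≡l+δ = begin
          + k               ≡⟨ split (+ k) (+ l) ⟩
          + l + (+ k - + l) ≈⟨ +-congˡ-mod (+ l) k-l≡δ ⟩
          + l + + δ         ≡⟨ ℤ.pos-+ l δ ⟨
          + (l ℕ.+ δ)       ∎

    exponent-collision : ∀ {ka kb kc kd} → + ka - + kb ≡ + kc - + kd mod n →
                         α ^ ka - α ^ kb ≡ α ^ kc - α ^ kd mod p → + ka ≡ + kb mod n ⊎ + kb ≡ + kd mod n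
    exponent-collision {ka} {kb} {kc} {kd} Δk Δα^k with ≡-mod-0⊎positive-residue n (+ ka - + kb)
    ... | inj₁ ka-kb≡0 = inj₁ (∣⇒≡-mod (≡-mod-0⇒∣ ka-kb≡0))
    ... | inj₂ (δ , 1≤δ , δ<n , ka-kb≡δ) = inj₂ (α^-injective α^kb≡α^kd)
      where
      α^δ-1≢0 : ¬ α ^ δ - + 1 ≡ + 0 mod p
      α^δ-1≢0 α^δ-1≡0 = α^k≢1 1≤δ δ<n (∣⇒≡-mod (≡-mod-0⇒∣ α^δ-1≡0))
      factor : ∀ u v → u * v - u ≡ (v - + 1) * u
      factor = solve-∀
      kc-kd≡δ : + kc - + kd ≡ + δ mod n
      kc-kd≡δ = ≡-mod-trans (≡-mod-sym Δk) ka-kb≡δ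
      α^kb≡α^kd : α ^ kb ≡ α ^ kd mod p
      α^kb≡α^kd = *-cancelˡ-≡-mod p-prime α^δ-1≢0 (begin
        (α ^ δ - + 1) * α ^ kb   ≡⟨ factor (α ^ kb) (α ^ δ) ⟨
        α ^ kb * α ^ δ - α ^ kb  ≈⟨ sub-congʳ-mod (α ^ kb) (α^-shift {ka} {kb} ka-kb≡δ) ⟨
        α ^ ka - α ^ kb          ≈⟨ Δα^k ⟩
        α ^ kc - α ^ kd          ≈⟨ sub-congʳ-mod (α ^ kd) (α^-shift {kc} {kd} kc-kd≡δ) ⟩
        α ^ kd * α ^ δ - α ^ kd  ≡⟨ factor (α ^ kd) (α ^ δ) ⟩
        (α ^ δ - + 1) * α ^ kd   ∎)
        where open ≡-mod-Reasoning p

    InR-difference-collision : ∀ a b c d → InR p α a → InR p α b → InR p α c → InR p α d →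
                               a -ᵖ b ≡ c -ᵖ d → InΛ (a -ᵖ b) ⊎ InΛ (b -ᵖ d)
    InR-difference-collision a b c d a∈R b∈R c∈R d∈R a-b≡c-d =
      Sum.map (≡-exponent⇒InΛ a b a∈R b∈R) (≡-exponent⇒InΛ b d b∈R d∈R) (exponent-collision Δk Δα^k)
      where
      ka = exponent a a∈R
      kb = exponent b b∈R
      kc = exponent c c∈R
      kd = exponent d d∈R
      Δk : + ka - + kb ≡ + kc - + kd mod n
      Δk = begin
        + ka - + kb       ≈⟨ sub-cong-mod (y≡exponent a a∈R) (y≡exponent b b∈R) ⟨
        proj₂ a - proj₂ b ≡⟨ cong proj₂ a-b≡c-d ⟩
        proj₂ c - proj₂ d ≈⟨ sub-cong-mod (y≡exponent c c∈R) (y≡exponent d d∈R) ⟩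
        + kc - + kd       ∎
        where open ≡-mod-Reasoning n
      Δα^k : α ^ ka - α ^ kb ≡ α ^ kc - α ^ kd mod p
      Δα^k = begin
        α ^ ka - α ^ kb   ≈⟨ sub-cong-mod (α^exponent≡x a a∈R) (α^exponent≡x b b∈R) ⟩
        proj₁ a - proj₁ b ≡⟨ cong proj₁ a-b≡c-d ⟩
        proj₁ c - proj₁ d ≈⟨ sub-cong-mod (α^exponent≡x c c∈R) (α^exponent≡x d d∈R) ⟨
        α ^ kc - α ^ kd   ∎
        where open ≡-mod-Reasoning p

    DistinctΛDifferences : List Point → Set
    DistinctΛDifferences L = ∀ {a b c d} → a ∈ L → b ∈ L → c ∈ L → d ∈ L →
                             a ≢ b → c ≢ d → InΛ (a -ᵖ b) → a -ᵖ b ≡ c -ᵖ d → a ≡ c × b ≡ d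

    distinct-differences : ∀ {L} → (∀ {q} → q ∈ L → InR p α q) → DistinctΛDifferences L →
                           ∀ {a b c d} → a ∈ L → b ∈ L → c ∈ L → d ∈ L →
                           a ≢ b → c ≢ d → a -ᵖ b ≡ c -ᵖ d → a ≡ c × b ≡ d
    distinct-differences L⊆R Λ-distinct {a} {b} {c} {d} a∈L b∈L c∈L d∈L a≢b c≢d a-b≡c-d =
      [ (λ a-b∈Λ → Λ-distinct a∈L b∈L c∈L d∈L a≢b c≢d a-b∈Λ a-b≡c-d) , via-b-d ]′
        (InR-difference-collision a b c d (L⊆R a∈L) (L⊆R b∈L) (L⊆R c∈L) (L⊆R d∈L) a-b≡c-d)
      where
      -- Here a - c = b - d ∈ Λ, so unless b = d the pairs (b , d) and (a , c) collide.
      via-b-d : InΛ (b -ᵖ d) → a ≡ c × b ≡ d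
      via-b-d b-d∈Λ with ≡-dec ℤ._≟_ ℤ._≟_ b d
      ... | yes refl = -ᵖ-cancelʳ {a} {b} {c} a-b≡c-d , refl
      ... | no b≢d   = contradiction (sym (proj₁ b≡a×d≡c)) a≢b
        where
        a≢c : a ≢ c
        a≢c refl = b≢d (-ᵖ-cancelˡ {a} {b} {d} a-b≡c-d)
        b≡a×d≡c : b ≡ a × d ≡ c
        b≡a×d≡c = Λ-distinct b∈L d∈L a∈L c∈L b≢d a≢c b-d∈Λ (-ᵖ-swap {a} {b} {c} {d} a-b≡c-d)

  -- The set 𝓑

  ≤-≤⇒offset : ∀ {a b k} → a ≤ b → b ≤ a + + k → ∃ λ s → s ℕ.≤ k × b ≡ a + + s
  ≤-≤⇒offset {a} {b} {k} a≤b b≤a+k = ∣ a - b ∣ , ℤ.drop‿+≤+ s≤k , b≡a+s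
    where
    s≡b-a : + ∣ a - b ∣ ≡ b - a
    s≡b-a = ℤ.∣-∣-≤ a≤b
    split : ∀ a b → b ≡ a + (b - a)
    split = solve-∀
    cancel : ∀ a k → (a + k) - a ≡ k
    cancel = solve-∀
    b≡a+s : b ≡ a + + ∣ a - b ∣
    b≡a+s = trans (split a b) (cong (λ u → a + u) (sym s≡b-a))
    s≤k : + ∣ a - b ∣ ≤ + k
    s≤k = subst₂ _≤_ (sym s≡b-a) (cancel a (+ k)) (ℤ.+-monoˡ-≤ (- a) b≤a+k)

  +-monoʳ-≤ᴺ : ∀ z {a b} → a ℕ.≤ b → z + + a ≤ z + + b
  +-monoʳ-≤ᴺ z a≤b = ℤ.+-monoʳ-≤ z (+≤+ a≤b)

  module Indices (m : ℕ) where

    -- row t is the point of 𝓑 in row j + t of S; up₀, right₀ and diag₁ are the points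
    -- (i, j + p - 1), (i + p, j) and (i + p + 1, j + p), i.e. the points in rows 0, 0 and 1
    -- translated by (0, n), (p, 0) and (p, n). wrapˣ and wrapʸ count these translations.
    data Index : Set where
      row : Fin (suc (suc m)) → Index
      up₀ right₀ diag₁ : Index

    row-of : Index → Fin (suc (suc m))
    row-of (row t) = t
    row-of up₀     = Fin.zero
    row-of right₀  = Fin.zero
    row-of diag₁   = Fin.suc Fin.zero

    wrapˣ wrapʸ : Index → ℤ
    wrapˣ (row _) = + 0
    wrapˣ up₀     = + 0
    wrapˣ right₀  = + 1
    wrapˣ diag₁   = + 1
    wrapʸ (row _) = + 0
    wrapʸ up₀     = + 1
    wrapʸ right₀  = + 0
    wrapʸ diag₁   = + 1

    wraps-injective : ∀ a b → row-of a ≡ row-of b → wrapˣ a ≡ wrapˣ b → wrapʸ a ≡ wrapʸ b → a ≡ b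
    wraps-injective (row _) (row _) s≡t _  _  = cong row s≡t
    wraps-injective (row _) up₀     _   _  ()
    wraps-injective (row _) right₀  _   () _
    wraps-injective (row _) diag₁   _   () _
    wraps-injective up₀     (row _) _   _  ()
    wraps-injective up₀     up₀     _   _  _  = refl
    wraps-injective up₀     right₀  _   () _
    wraps-injective up₀     diag₁   ()  _  _
    wraps-injective right₀  (row _) _   () _
    wraps-injective right₀  up₀     _   () _
    wraps-injective right₀  right₀  _   _  _  = refl
    wraps-injective right₀  diag₁   ()  _  _
    wraps-injective diag₁   (row _) _   () _
    wraps-injective diag₁   up₀     ()  _  _
    wraps-injective diag₁   right₀  ()  _  _
    wraps-injective diag₁   diag₁   _   _  _  = refl

    -- The wrap differences of distinct indices in the same row are all different, so they
    -- determine the pair.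
    decode : ℤ → ℤ → Maybe (Index × Index)
    decode (+ 0)      -[1+ 0 ]   = just (row Fin.zero , up₀)
    decode (+ 0)      (+ 1)      = just (up₀ , row Fin.zero)
    decode -[1+ 0 ]   (+ 0)      = just (row Fin.zero , right₀)
    decode (+ 1)      (+ 0)      = just (right₀ , row Fin.zero)
    decode -[1+ 0 ]   (+ 1)      = just (up₀ , right₀)
    decode (+ 1)      -[1+ 0 ]   = just (right₀ , up₀)
    decode -[1+ 0 ]   -[1+ 0 ]   = just (row (Fin.suc Fin.zero) , diag₁)
    decode (+ 1)      (+ 1)      = just (diag₁ , row (Fin.suc Fin.zero))
    decode _          _          = nothing

    decode-wraps : ∀ a b → row-of a ≡ row-of b → a ≢ b →
                   decode (wrapˣ a - wrapˣ b) (wrapʸ a - wrapʸ b) ≡ just (a , b)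
    decode-wraps (row _) (row _) refl a≢b = contradiction refl a≢b
    decode-wraps (row _) up₀     refl _   = refl
    decode-wraps (row _) right₀  refl _   = refl
    decode-wraps (row _) diag₁   refl _   = refl
    decode-wraps up₀     (row _) refl _   = refl
    decode-wraps up₀     up₀     _    a≢b = contradiction refl a≢b
    decode-wraps up₀     right₀  _    _   = refl
    decode-wraps up₀     diag₁   ()   _
    decode-wraps right₀  (row _) refl _   = refl
    decode-wraps right₀  up₀     _    _   = refl
    decode-wraps right₀  right₀  _    a≢b = contradiction refl a≢b
    decode-wraps right₀  diag₁   ()   _
    decode-wraps diag₁   (row _) refl _   = refl
    decode-wraps diag₁   up₀     ()   _
    decode-wraps diag₁   right₀  ()   _
    decode-wraps diag₁   diag₁   _    a≢b = contradiction refl a≢b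

    wraps-determine-pair : ∀ {a b c d} → row-of a ≡ row-of b → row-of c ≡ row-of d → a ≢ b → c ≢ d →
                           wrapˣ a - wrapˣ b ≡ wrapˣ c - wrapˣ d → wrapʸ a - wrapʸ b ≡ wrapʸ c - wrapʸ d →
                           a ≡ c × b ≡ d
    wraps-determine-pair {a} {b} {c} {d} ab cd a≢b c≢d Δx Δy
      with trans (sym (decode-wraps a b ab a≢b)) (trans (cong₂ decode Δx Δy) (decode-wraps c d cd c≢d))
    ... | refl = refl , refl


  module Construction (m : ℕ) (p-prime : Prime (3 ℕ.+ m)) (α : ℤ) (α-primitive : PrimitiveRoot (3 ℕ.+ m) α)
                      (i j : ℤ) (ij∈R : InR (3 ℕ.+ m) α (i , j))
                      (next∈R : InR (3 ℕ.+ m) α (i + + 1 , j + + 1)) where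

    n : ℕ
    n = suc (suc m)

    open PrimitiveRootModulo n p-prime α α-primitive
    open Indices m

    k₀ : ℕ
    k₀ = exponent (i , j) ij∈R

    offset : ℕ → ℕ
    offset t = (α ^ (k₀ ℕ.+ t) - i) %ℕ p

    offset<p : ∀ t → offset t ℕ.< p
    offset<p t = %ℕ-< p (α ^ (k₀ ℕ.+ t) - i)

    row-point : ℕ → Point
    row-point t = (i + + offset t , j + + t)

    row-point∈R : ∀ t → InR p α (row-point t)
    row-point∈R t = exponent⇒InR (k₀ ℕ.+ t) j+t≡k₀+t α^[k₀+t]≡i+offset
      where
      j+t≡k₀+t : j + + t ≡ + (k₀ ℕ.+ t) mod n
      j+t≡k₀+t = ≡-mod-trans (+-cong-mod (y≡exponent (i , j) ij∈R) ≡-mod-refl)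
                             (≡-mod-reflexive (sym (ℤ.pos-+ k₀ t)))
      split : ∀ a i → a ≡ i + (a - i)
      split = solve-∀
      α^[k₀+t]≡i+offset : α ^ (k₀ ℕ.+ t) ≡ i + + offset t mod p
      α^[k₀+t]≡i+offset = ≡-mod-trans (≡-mod-reflexive (split (α ^ (k₀ ℕ.+ t)) i))
                                      (+-congˡ-mod i (≡-%ℕ-mod p (α ^ (k₀ ℕ.+ t) - i)))

    offset-unique : ∀ t s → s ℕ.< p → InR p α (i + + s , j + + t) → s ≡ offset t
    offset-unique t s s<p is∈R =
      ≡-mod⇒≡ s<p (offset<p t)
        (+-cancelˡ-≡-mod {c = i} (InR-functional (i + + s , j + + t) (row-point t) is∈R (row-point∈R t) ≡-mod-refl))

    offset-0 : offset 0 ≡ 0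
    offset-0 = sym (offset-unique 0 0 (ℕ.s≤s ℕ.z≤n)
      (InR-resp-≡-mod (≡-mod-reflexive (sym (ℤ.+-identityʳ i))) (≡-mod-reflexive (sym (ℤ.+-identityʳ j))) ij∈R))

    offset-1 : offset 1 ≡ 1
    offset-1 = sym (offset-unique 1 1 (ℕ.s≤s (ℕ.s≤s ℕ.z≤n)) next∈R)

    point : Index → Point
    point (row t) = row-point (toℕ t)
    point up₀     = (i , j + + n)
    point right₀  = (i + + p , j)
    point diag₁   = (i + + (p ℕ.+ 1) , j + + p)

    private
      no-wrap : ∀ z x w → z + x ≡ z + (x + + 0 * w)
      no-wrap = solve-∀

      one-wrap : ∀ z x w → z + (x + w) ≡ z + (x + + 1 * w)
      one-wrap = solve-∀

      at-offset : ∀ {r o} u → offset r ≡ o → i + (+ o + u * + p) ≡ i + (+ offset r + u * + p)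
      at-offset u offset≡o = cong (λ o → i + (+ o + u * + p)) (sym offset≡o)

    point-wrapped : ∀ a → point a ≡ (i + (+ offset (toℕ (row-of a)) + wrapˣ a * + p) ,
                                     j + (+ toℕ (row-of a) + wrapʸ a * + n))
    point-wrapped (row t) = cong₂ _,_ (no-wrap i (+ offset (toℕ t)) (+ p)) (no-wrap j (+ toℕ t) (+ n))
    point-wrapped up₀ =
      cong₂ _,_ (trans (sym (ℤ.+-identityʳ i)) (trans (no-wrap i (+ 0) (+ p)) (at-offset (+ 0) offset-0)))
                (one-wrap j (+ 0) (+ n))
    point-wrapped right₀ =
      cong₂ _,_ (trans (one-wrap i (+ 0) (+ p)) (at-offset (+ 1) offset-0))
                (trans (sym (ℤ.+-identityʳ j)) (no-wrap j (+ 0) (+ n)))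
    point-wrapped diag₁ =
      cong₂ _,_ (trans (cong (λ u → i + + u) (ℕ.+-comm p 1)) (trans (one-wrap i (+ 1) (+ p)) (at-offset (+ 1) offset-1)))
                (one-wrap j (+ 1) (+ n))

    same-row-difference : ∀ a b → row-of a ≡ row-of b →
                          point a -ᵖ point b ≡ ((wrapˣ a - wrapˣ b) * + p , (wrapʸ a - wrapʸ b) * + n)
    same-row-difference a b ab = begin
      point a -ᵖ point b
        ≡⟨ cong₂ _-ᵖ_ (point-wrapped a) (trans (point-wrapped b) (cong (wrapped-at b) (sym ab))) ⟩
      wrapped-at a (row-of a) -ᵖ wrapped-at b (row-of a)
        ≡⟨ cong₂ _,_ (cancel i (+ offset (toℕ (row-of a))) (wrapˣ a) (wrapˣ b) (+ p))
                     (cancel j (+ toℕ (row-of a)) (wrapʸ a) (wrapʸ b) (+ n)) ⟩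
      ((wrapˣ a - wrapˣ b) * + p , (wrapʸ a - wrapʸ b) * + n)
        ∎
      where
      open ≡-Reasoning
      wrapped-at : Index → Fin n → Point
      wrapped-at a r = (i + (+ offset (toℕ r) + wrapˣ a * + p) , j + (+ toℕ r + wrapʸ a * + n))
      cancel : ∀ z o u u′ w → (z + (o + u * w)) - (z + (o + u′ * w)) ≡ (u - u′) * w
      cancel = solve-∀

    point-y≡row : ∀ a → proj₂ (point a) ≡ j + + toℕ (row-of a) mod n
    point-y≡row a = ≡-mod-trans (≡-mod-reflexive (cong proj₂ (point-wrapped a)))
                                (+-congˡ-mod j (+-multiple-≡-mod (+ toℕ (row-of a)) (wrapʸ a)))

    same-row : ∀ a b → InΛ (point a -ᵖ point b) → row-of a ≡ row-of b
    same-row a b (_ , n∣Δy) = Fin.toℕ-injective (≡-mod⇒≡ (Fin.toℕ<n (row-of a)) (Fin.toℕ<n (row-of b))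
      (+-cancelˡ-≡-mod {c = j}
        (≡-mod-trans (≡-mod-sym (point-y≡row a)) (≡-mod-trans (∣⇒≡-mod n∣Δy) (point-y≡row b)))))

    point-Λ-distinct : ∀ a b c d → point a ≢ point b → point c ≢ point d → InΛ (point a -ᵖ point b) →
                       point a -ᵖ point b ≡ point c -ᵖ point d → a ≡ c × b ≡ d
    point-Λ-distinct a b c d pa≢pb pc≢pd ab∈Λ ab≡cd =
      wraps-determine-pair a~b c~d (pa≢pb ∘ cong point) (pc≢pd ∘ cong point)
        (ℤ.*-cancelʳ-≡ _ _ (+ p) (cong proj₁ wraps-eq)) (ℤ.*-cancelʳ-≡ _ _ (+ n) (cong proj₂ wraps-eq))
      where
      a~b = same-row a b ab∈Λ
      c~d = same-row c d (subst InΛ ab≡cd ab∈Λ)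
      wraps-eq = trans (sym (same-row-difference a b a~b)) (trans ab≡cd (same-row-difference c d c~d))

    point-injective : ∀ {a b} → point a ≡ point b → a ≡ b
    point-injective {a} {b} pa≡pb =
      wraps-injective a b a~b (wrap-eq (+ p) (cong proj₁ wraps-zero)) (wrap-eq (+ n) (cong proj₂ wraps-zero))
      where
      a~b = same-row a b
        (≡-mod⇒∣ (≡-mod-reflexive (cong proj₁ pa≡pb)) , ≡-mod⇒∣ (≡-mod-reflexive (cong proj₂ pa≡pb)))
      wraps-zero : ((wrapˣ a - wrapˣ b) * + p , (wrapʸ a - wrapʸ b) * + n) ≡ (+ 0 , + 0)
      wraps-zero = begin
        ((wrapˣ a - wrapˣ b) * + p , (wrapʸ a - wrapʸ b) * + n) ≡⟨ same-row-difference a b a~b ⟨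
        point a -ᵖ point b                                     ≡⟨ cong (_-ᵖ point b) pa≡pb ⟩
        point b -ᵖ point b                                     ≡⟨ cong₂ _,_ (ℤ.+-inverseʳ xb) (ℤ.+-inverseʳ yb) ⟩
        (+ 0 , + 0)                                            ∎
        where
        open ≡-Reasoning
        xb = proj₁ (point b)
        yb = proj₂ (point b)
      wrap-eq : ∀ {u v} w .{{_ : NonZero w}} → (u - v) * w ≡ + 0 → u ≡ v
      wrap-eq {u} {v} w Δ≡0 = ℤ.i-j≡0⇒i≡j u v (ℤ.*-cancelʳ-≡ (u - v) (+ 0) w Δ≡0)

    indices : List Index
    indices = up₀ ∷ right₀ ∷ diag₁ ∷ map row (allFin n)

    index∈indices : ∀ a → a ∈ indices
    index∈indices up₀     = here refl
    index∈indices right₀  = there (here refl)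
    index∈indices diag₁   = there (there (here refl))
    index∈indices (row t) = there (there (there (∈-map⁺ row (∈-allFin t))))

    indices-unique : Unique indices
    indices-unique = ((λ ()) ∷ (λ ()) ∷ not-row (λ _ ())) ∷ ((λ ()) ∷ not-row (λ _ ())) ∷ not-row (λ _ ()) ∷
                     Unique.map⁺ (λ { refl → refl }) (Unique.allFin⁺ n)
      where
      not-row : ∀ {a} → (∀ t → a ≢ row t) → All (a ≢_) (map row (allFin n))
      not-row a≢row = All.map⁺ (All.universal a≢row (allFin n))

    points : List Point
    points = map point indices

    point∈points : ∀ a → point a ∈ points
    point∈points a = ∈-map⁺ point (index∈indices a)

    ∈points⇒point : ∀ {q} → q ∈ points → ∃ λ a → q ≡ point a
    ∈points⇒point q∈points with ∈-map⁻ point {xs = indices} q∈points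
    ... | a , _ , q≡pa = a , q≡pa

    points-length : length points ≡ p ℕ.+ 2
    points-length = begin
      length (map point indices)        ≡⟨ length-map point indices ⟩
      3 ℕ.+ length (map row (allFin n)) ≡⟨ cong (3 ℕ.+_) (length-map row (allFin n)) ⟩
      3 ℕ.+ length (allFin n)           ≡⟨ cong (3 ℕ.+_) (length-tabulate id) ⟩
      3 ℕ.+ n                           ≡⟨ cong (3 ℕ.+_) (ℕ.+-comm 2 m) ⟩
      p ℕ.+ 2                           ∎
      where open ≡-Reasoning

    points-unique : Unique points
    points-unique = Unique.map⁺ point-injective indices-unique

    point∈R : ∀ a → InR p α (point a)
    point∈R (row t) = row-point∈R (toℕ t)
    point∈R up₀     = InR-resp-≡-mod {i} {j} ≡-mod-refl (≡-mod-sym (+-modulus-≡-mod j)) ij∈R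
    point∈R right₀  = InR-resp-≡-mod {i} {j} (≡-mod-sym (+-modulus-≡-mod i)) ≡-mod-refl ij∈R
    point∈R diag₁   = InR-resp-≡-mod {i + + 1} {j + + 1}
      (≡-mod-trans (≡-mod-sym (+-modulus-≡-mod (i + + 1)))
                   (≡-mod-reflexive (trans (ℤ.+-assoc i (+ 1) (+ p)) (cong (λ k → i + + k) (ℕ.+-comm 1 p)))))
      (≡-mod-trans (≡-mod-sym (+-modulus-≡-mod (j + + 1))) (≡-mod-reflexive (ℤ.+-assoc j (+ 1) (+ n))))
      next∈R

    points⊆R : ∀ {q} → q ∈ points → InR p α q
    points⊆R q∈points with ∈points⇒point q∈points
    ... | a , refl = point∈R a

    points-Λ-distinct : DistinctΛDifferences points
    points-Λ-distinct a∈ b∈ c∈ d∈ with ∈points⇒point a∈ | ∈points⇒point b∈ | ∈points⇒point c∈ | ∈points⇒point d∈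
    ... | a , refl | b , refl | c , refl | d , refl = λ pa≢pb pc≢pd ab∈Λ ab≡cd →
      Product.map (cong point) (cong point) (point-Λ-distinct a b c d pa≢pb pc≢pd ab∈Λ ab≡cd)

    row-point∈S : ∀ {t} → t ℕ.< n → InS p i j (row-point t)
    row-point∈S {t} t<n = ℤ.i≤i+j i (+ offset t) , +-monoʳ-≤ᴺ i (ℕ.≤-pred (offset<p t)) ,
                          ℤ.i≤i+j j (+ t)        , +-monoʳ-≤ᴺ j (ℕ.≤-pred t<n)

    point-InB : ∀ a → InB p α i j (point a)
    point-InB (row t) = inj₁ (row-point∈R (toℕ t) , row-point∈S (Fin.toℕ<n t))
    point-InB up₀     = inj₂ (inj₁ refl)
    point-InB right₀  = inj₂ (inj₂ (inj₁ refl))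
    point-InB diag₁   = inj₂ (inj₂ (inj₂ refl))

    R∩S⇒row-point : ∀ q → InR p α q → InS p i j q → ∃ λ t → q ≡ point (row t)
    R∩S⇒row-point (x , y) q∈R (i≤x , x≤i+n , j≤y , y≤j+m+1)
      with ≤-≤⇒offset i≤x x≤i+n | ≤-≤⇒offset j≤y y≤j+m+1
    ... | s , s≤n , refl | t , t≤m+1 , refl = fromℕ< t<n , (begin
      (i + + s , j + + t)                 ≡⟨ cong (λ o → (i + + o , j + + t)) s≡offset ⟩
      row-point t                         ≡⟨ cong row-point (Fin.toℕ-fromℕ< t<n) ⟨
      row-point (toℕ (fromℕ< t<n))        ∎)
      where
      open ≡-Reasoning
      t<n : t ℕ.< n
      t<n = ℕ.s≤s t≤m+1
      s≡offset : s ≡ offset t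
      s≡offset = offset-unique t s (ℕ.s≤s s≤n) q∈R

    ∈points⇔InB : ∀ q → (q ∈ points) ⇔ InB p α i j q
    ∈points⇔InB q = mk⇔ ∈points⇒InB InB⇒∈points
      where
      ∈points⇒InB : q ∈ points → InB p α i j q
      ∈points⇒InB q∈points with ∈points⇒point q∈points
      ... | a , refl = point-InB a
      InB⇒∈points : InB p α i j q → q ∈ points
      InB⇒∈points (inj₁ (q∈R , q∈S)) with R∩S⇒row-point q q∈R q∈S
      ... | t , refl = point∈points (row t)
      InB⇒∈points (inj₂ (inj₁ refl))        = point∈points up₀
      InB⇒∈points (inj₂ (inj₂ (inj₁ refl))) = point∈points right₀
      InB⇒∈points (inj₂ (inj₂ (inj₂ refl))) = point∈points diag₁

    point-InRect : ∀ a → InRect p i j (point a)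
    point-InRect (row t) =
      ℤ.i≤i+j i (+ offset (toℕ t)) , +-monoʳ-≤ᴺ i (ℕ.≤-trans (ℕ.<⇒≤ (offset<p (toℕ t))) (ℕ.m≤m+n p 1)) ,
      ℤ.i≤i+j j (+ toℕ t)          , +-monoʳ-≤ᴺ j (ℕ.≤-trans (ℕ.<⇒≤ (Fin.toℕ<n t)) (ℕ.n≤1+n n))
    point-InRect up₀     = ℤ.≤-refl , ℤ.i≤i+j i (+ (p ℕ.+ 1)) , ℤ.i≤i+j j (+ n) , +-monoʳ-≤ᴺ j (ℕ.n≤1+n n)
    point-InRect right₀  = ℤ.i≤i+j i (+ p) , +-monoʳ-≤ᴺ i (ℕ.m≤m+n p 1) , ℤ.≤-refl , ℤ.i≤i+j j (+ p)
    point-InRect diag₁   = ℤ.i≤i+j i (+ (p ℕ.+ 1)) , ℤ.≤-refl , ℤ.i≤i+j j (+ p) , ℤ.≤-refl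

    points⊆Rect : ∀ q → q ∈ points → InRect p i j q
    points⊆Rect q q∈points with ∈points⇒point q∈points
    ... | a , refl = point-InRect a

    points-DD : IsDD (p ℕ.+ 2) points
    points-DD = points-length , points-unique , distinct-differences points⊆R points-Λ-distinct


open import Data.Nat using (ℕ; _+_)
open import Data.Nat.Primality using (Prime)
open import Data.Integer using (ℤ; +_) renaming (_+_ to _+ℤ_)
open import Data.Product using (_×_; _,_; ∃)
open import Data.List using (List)
open import Data.List.Membership.Propositional using (_∈_)
open import Function.Bundles using (_⇔_)
open import Relation.Binary.PropositionalEquality using (_≢_; refl)
open import Data.Nat using (suc)
open import Data.Nat.Primality using (¬prime[0]; ¬prime[1])
open import Relation.Nullary using (contradiction)

lemma5 : (p : ℕ) → Prime p → p ≢ 2 →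
    (α : ℤ) → PrimitiveRoot p α →
    (i j : ℤ) → InR p α (i , j) → InR p α (i +ℤ + 1 , j +ℤ + 1) →
    ∃ λ (L : List Point) →
      (∀ q → (q ∈ L) ⇔ InB p α i j q) ×
      IsDD (p + 2) L ×
      (∀ q → q ∈ L → InRect p i j q)
lemma5 0 p-prime = contradiction p-prime ¬prime[0]
lemma5 1 p-prime = contradiction p-prime ¬prime[1]
lemma5 2 _ p≢2 = contradiction refl p≢2
lemma5 (suc (suc (suc m))) p-prime _ α α-primitive i j ij∈R next∈R =
  points , ∈points⇔InB , points-DD , points⊆Rect
  where open Construction m p-prime α α-primitive i j ij∈R next∈R
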